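{- Let $G$ be an interval graph and let $I$ and $J$ be two independent sets of $G$ of size $k$ such that there exists a token-sliding reconfiguration sequence from $I$ to $J$. Let $u$ be the leftmost vertex of $I$, $v$ the leftmost vertex of $J$, and $w$ the $\prec_r$-smallest vertex among the leftmost vertices of all independent sets in this sequence. Then there exists a token-sliding reconfiguration from $I\setminus\{u\}$ into $J\setminus\{v\}$ in $G_w$.
   Context: Each vertex $x$ of $G$ is represented by an interval with left extremity $l(x)$ and right extremity $r(x)$, all extremities pairwise distinct; vertices are adjacent iff their intervals intersect. $x\prec_r y$ means $r(x)<r(y)$. For a vertex $w$, $G_w$ is the subgraph induced by the vertices $x$ with $l(x)>r(w)$. The leftmost vertex of an independent set is the one with smallest left (equivalently right) extremity. A token-sliding reconfiguration sequence is a sequence of independent sets of the same size in which consecutive sets $A,B$ satisfy $A\setminus B=\{x\}$, $B\setminus A=\{y\}$ with $xy$ an edge. -}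

module Defs where

open import Data.Nat using (ℕ; _≤_; _<_; _∸_)
open import Data.Fin using (Fin)
open import Data.Fin.Subset using (Subset; _∈_; _─_; ⁅_⁆; ∣_∣)
open import Data.Product using (_×_; Σ; ∃)
open import Data.Unit using (⊤)
open import Relation.Nullary using (¬_)
open import Relation.Binary.PropositionalEquality using (_≡_; _≢_)

-- An interval graph on vertex set Fin n, given by an interval model:
-- vertex x is the closed interval [l x , r x]; all 2n extremities pairwise distinct.
record IntervalGraph (n : ℕ) : Set where
  field
    l r   : Fin n → ℕ
    l<r   : ∀ x → l x < r x
    l-inj : ∀ x y → l x ≡ l y → x ≡ y
    r-inj : ∀ x y → r x ≡ r y → x ≡ y
    l≢r   : ∀ x y → l x ≢ r y

AllV : ∀ {n} → Fin n → Set
AllV _ = ⊤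

module _ {n : ℕ} (G : IntervalGraph n) where
  open IntervalGraph G

  Adj : Fin n → Fin n → Set
  Adj x y = x ≢ y × l x ≤ r y × l y ≤ r x

  Independent : Subset n → Set
  Independent S = ∀ x y → x ∈ S → y ∈ S → ¬ Adj x y

  -- independent set of size k all of whose vertices satisfy P
  -- (P selects the vertices of an induced subgraph; P = ⊤ gives G itself)
  IndepIn : (Fin n → Set) → ℕ → Subset n → Set
  IndepIn P k S = Independent S × ∣ S ∣ ≡ k × (∀ x → x ∈ S → P x)

  TSStep : Subset n → Subset n → Set
  TSStep A B = Σ (Fin n) λ x → Σ (Fin n) λ y →
    (A ─ B ≡ ⁅ x ⁆) × (B ─ A ≡ ⁅ y ⁆) × Adj x y

  data Reconf (P : Fin n → Set) (k : ℕ) : Subset n → Subset n → Set where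
    done : ∀ {A} → IndepIn P k A → Reconf P k A A
    step : ∀ {A B C} → IndepIn P k A → TSStep A B → Reconf P k B C → Reconf P k A C

  data _∈Seq_ {P : Fin n → Set} {k : ℕ} (S : Subset n) :
      {A B : Subset n} → Reconf P k A B → Set where
    here-done : ∀ {p} → S ∈Seq done {A = S} p
    here-step : ∀ {B C p s} {q : Reconf P k B C} → S ∈Seq step {A = S} p s q
    there     : ∀ {A B C p s} {q : Reconf P k B C} → S ∈Seq q → S ∈Seq step {A = A} p s q

  IsLeftmost : Subset n → Fin n → Set
  IsLeftmost S x = x ∈ S × (∀ y → y ∈ S → l x ≤ l y)

  InGw : Fin n → Fin n → Set
  InGw w x = r w < l x

-- Sliding a token other than the leftmost one u keeps u leftmost, and the same slide
-- is legal once u is deleted.  Sliding the leftmost token u to y leaves the other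
-- tokens in place, and y becomes the new leftmost token since l y ≤ r u < l t for
-- every other token t.  Deleting the leftmost token then turns every set of the
-- sequence into an independent set of G_w, since its tokens start after r u ≥ r w.
module Submission where

open import Defs
open import Data.Nat using (ℕ; _≤_; _<_; _∸_; suc)
open import Data.Nat.Properties using (≤-refl; <⇒≤; <-trans; ≤-<-trans; ≰⇒>; ≤∧≢⇒<; ≤-antisym; <-irrefl; _≤?_; module ≤-Reasoning)
open import Data.Fin using (Fin; _≟_)
open import Data.Fin.Subset using (Subset; _∈_; _∉_; _─_; _-_; _∩_; ⁅_⁆; ∣_∣; inside; outside)
open import Data.Fin.Subset.Properties using (x∈⁅x⁆; x∈⁅y⁆⇒x≡y; x∉⁅y⁆⇒x≢y; x∈p∧x≢y⇒x∈p-y; p─q⊆p; p─⊥≡p; ⊆-antisym; ∩-comm)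
open import Data.Vec using ([]; _∷_; here; there)
open import Data.Product using (_×_; Σ; _,_; proj₁; proj₂)
open import Data.Empty using (⊥-elim)
open import Relation.Nullary using (yes; no)
open import Relation.Binary.PropositionalEquality using (_≡_; _≢_; refl; sym; trans; cong; subst; module ≡-Reasoning)

x∈p─q⇒x∉q : ∀ {n} {p q : Subset n} {x} → x ∈ p ─ q → x ∉ q
x∈p─q⇒x∉q {p = _ ∷ p} {inside  ∷ q} (there x∈) (there x∈q) = x∈p─q⇒x∉q {p = p} x∈ x∈q
x∈p─q⇒x∉q {p = _ ∷ p} {outside ∷ q} (there x∈) (there x∈q) = x∈p─q⇒x∉q {p = p} x∈ x∈q

x∈p-y⁻ : ∀ {n} {p : Subset n} {x y} → x ∈ p - y → x ∈ p × x ≢ y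
x∈p-y⁻ {p = p} x∈ = p─q⊆p p _ x∈ , x∉⁅y⁆⇒x≢y (x∈p─q⇒x∉q {p = p} x∈)

x∈p⇒suc∣p-x∣≡∣p∣ : ∀ {n} {p : Subset n} {x} → x ∈ p → suc ∣ p - x ∣ ≡ ∣ p ∣
x∈p⇒suc∣p-x∣≡∣p∣ {p = inside  ∷ p} here       = cong (λ s → suc ∣ s ∣) (p─⊥≡p p)
x∈p⇒suc∣p-x∣≡∣p∣ {p = inside  ∷ p} (there x∈) = cong suc (x∈p⇒suc∣p-x∣≡∣p∣ x∈)
x∈p⇒suc∣p-x∣≡∣p∣ {p = outside ∷ p} (there x∈) = x∈p⇒suc∣p-x∣≡∣p∣ x∈

p─[p─q]≡p∩q : ∀ {n} (p q : Subset n) → p ─ (p ─ q) ≡ p ∩ q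
p─[p─q]≡p∩q []            []            = refl
p─[p─q]≡p∩q (inside  ∷ p) (inside  ∷ q) = cong (inside ∷_) (p─[p─q]≡p∩q p q)
p─[p─q]≡p∩q (inside  ∷ p) (outside ∷ q) = cong (outside ∷_) (p─[p─q]≡p∩q p q)
p─[p─q]≡p∩q (outside ∷ p) (inside  ∷ q) = cong (outside ∷_) (p─[p─q]≡p∩q p q)
p─[p─q]≡p∩q (outside ∷ p) (outside ∷ q) = cong (outside ∷_) (p─[p─q]≡p∩q p q)

p─r─[q─r]≡p─q─r : ∀ {n} (p q r : Subset n) → (p ─ r) ─ (q ─ r) ≡ p ─ q ─ r
p─r─[q─r]≡p─q─r []      []      []            = refl
p─r─[q─r]≡p─q─r (x ∷ p) (y ∷ q) (inside  ∷ r) = cong (outside ∷_) (p─r─[q─r]≡p─q─r p q r)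
p─r─[q─r]≡p─q─r (x ∷ p) (inside  ∷ q) (outside ∷ r) = cong (outside ∷_) (p─r─[q─r]≡p─q─r p q r)
p─r─[q─r]≡p─q─r (x ∷ p) (outside ∷ q) (outside ∷ r) = cong (x ∷_) (p─r─[q─r]≡p─q─r p q r)

x≢y⇒⁅x⁆-y≡⁅x⁆ : ∀ {n} {x y : Fin n} → x ≢ y → ⁅ x ⁆ - y ≡ ⁅ x ⁆
x≢y⇒⁅x⁆-y≡⁅x⁆ {x = x} x≢y = ⊆-antisym (p─q⊆p ⁅ x ⁆ _) λ t∈⁅x⁆ →
  x∈p∧x≢y⇒x∈p-y t∈⁅x⁆ (subst (_≢ _) (sym (x∈⁅y⁆⇒x≡y x t∈⁅x⁆)) x≢y)

module _ {n} {p q : Subset n} {x y : Fin n} (p─q≡x : p ─ q ≡ ⁅ x ⁆) (q─p≡y : q ─ p ≡ ⁅ y ⁆) where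

  slide-p-x≡q-y : p - x ≡ q - y
  slide-p-x≡q-y = begin
    p ─ ⁅ x ⁆     ≡⟨ cong (p ─_) p─q≡x ⟨
    p ─ (p ─ q)   ≡⟨ p─[p─q]≡p∩q p q ⟩
    p ∩ q         ≡⟨ ∩-comm p q ⟩
    q ∩ p         ≡⟨ p─[p─q]≡p∩q q p ⟨
    q ─ (q ─ p)   ≡⟨ cong (q ─_) q─p≡y ⟩
    q ─ ⁅ y ⁆     ∎
    where open ≡-Reasoning

  slide-⁻ : ∀ {t} → t ∈ q → t ≢ y → t ∈ p × t ≢ x
  slide-⁻ t∈q t≢y = x∈p-y⁻ {p = p} (subst (_ ∈_) (sym slide-p-x≡q-y) (x∈p∧x≢y⇒x∈p-y t∈q t≢y))

  slide-⁺ : ∀ {t} → t ∈ p → t ≢ x → t ∈ q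
  slide-⁺ t∈p t≢x = proj₁ (x∈p-y⁻ {p = q} (subst (_ ∈_) slide-p-x≡q-y (x∈p∧x≢y⇒x∈p-y t∈p t≢x)))

  slide-source : x ∈ p × x ∉ q
  slide-source = p─q⊆p p q x∈ , x∈p─q⇒x∉q {p = p} x∈
    where
    x∈ : x ∈ p ─ q
    x∈ = subst (x ∈_) (sym p─q≡x) (x∈⁅x⁆ x)

  slide-target : y ∈ q × y ∉ p
  slide-target = p─q⊆p q p y∈ , x∈p─q⇒x∉q {p = q} y∈
    where
    y∈ : y ∈ q ─ p
    y∈ = subst (y ∈_) (sym q─p≡y) (x∈⁅x⁆ y)

p─q≡⁅x⁆⇒p-z─[q-z]≡⁅x⁆ : ∀ {n} {p q : Subset n} {x z} → p ─ q ≡ ⁅ x ⁆ → x ≢ z → (p - z) ─ (q - z) ≡ ⁅ x ⁆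
p─q≡⁅x⁆⇒p-z─[q-z]≡⁅x⁆ {p = p} {q} {x} {z} p─q≡x x≢z = begin
  (p - z) ─ (q - z)   ≡⟨ p─r─[q─r]≡p─q─r p q ⁅ z ⁆ ⟩
  p ─ q - z           ≡⟨ cong (_- z) p─q≡x ⟩
  ⁅ x ⁆ - z           ≡⟨ x≢y⇒⁅x⁆-y≡⁅x⁆ x≢z ⟩
  ⁅ x ⁆               ∎
  where open ≡-Reasoning

module _ {n} (G : IntervalGraph n) where
  open IntervalGraph G

  independent-l<l⇒r<l : ∀ {S a b} → Independent G S → a ∈ S → b ∈ S → l a < l b → r a < l b
  independent-l<l⇒r<l {a = a} {b} ind a∈S b∈S la<lb with l b ≤? r a
  ... | no  lb≰ra = ≰⇒> lb≰ra
  ... | yes lb≤ra = ⊥-elim (ind a b a∈S b∈S (a≢b , <⇒≤ (<-trans la<lb (l<r b)) , lb≤ra))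
    where
    a≢b : a ≢ b
    a≢b refl = <-irrefl refl la<lb

  leftmost-unique : ∀ {S u v} → IsLeftmost G S u → IsLeftmost G S v → u ≡ v
  leftmost-unique (u∈S , u≤) (v∈S , v≤) = l-inj _ _ (≤-antisym (u≤ _ v∈S) (v≤ _ u∈S))

  leftmost-r<l : ∀ {S u t} → Independent G S → IsLeftmost G S u → t ∈ S → t ≢ u → r u < l t
  leftmost-r<l ind (u∈S , u≤) t∈S t≢u =
    independent-l<l⇒r<l ind u∈S t∈S (≤∧≢⇒< (u≤ _ t∈S) (λ lu≡lt → t≢u (sym (l-inj _ _ lu≡lt))))

  IndepIn-drop-leftmost : ∀ {k S u w} → IndepIn G AllV k S → IsLeftmost G S u → r w ≤ r u
                        → IndepIn G (InGw G w) (k ∸ 1) (S - u)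
  IndepIn-drop-leftmost {S = S} (ind , ∣S∣≡k , _) lm@(u∈S , _) rw≤ru =
    (λ a b a∈ b∈ → ind a b (p─q⊆p S _ a∈) (p─q⊆p S _ b∈)) ,
    cong (_∸ 1) (trans (x∈p⇒suc∣p-x∣≡∣p∣ u∈S) ∣S∣≡k) ,
    λ t t∈ → let (t∈S , t≢u) = x∈p-y⁻ {p = S} t∈ in ≤-<-trans rw≤ru (leftmost-r<l ind lm t∈S t≢u)

  module _ {A B : Subset n} {x y : Fin n} (A─B≡x : A ─ B ≡ ⁅ x ⁆) (B─A≡y : B ─ A ≡ ⁅ y ⁆)
           (adj : Adj G x y) (indA : Independent G A) where

    slide-leftmost : IsLeftmost G A x → IsLeftmost G B y
    slide-leftmost lmx = proj₁ (slide-target A─B≡x B─A≡y) , y≤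
      where
      y≤ : ∀ t → t ∈ B → l y ≤ l t
      y≤ t t∈B with t ≟ y
      ... | yes refl = ≤-refl
      ... | no  t≢y  = let (t∈A , t≢x) = slide-⁻ A─B≡x B─A≡y t∈B t≢y in
        <⇒≤ (≤-<-trans (proj₂ (proj₂ adj)) (leftmost-r<l indA lmx t∈A t≢x))

    slide-keeps-leftmost : ∀ {u} → Independent G B → IsLeftmost G A u → x ≢ u → IsLeftmost G B u
    slide-keeps-leftmost {u} indB lmu@(u∈A , u≤) x≢u = u∈B , u≤′
      where
      u∈B : u ∈ B
      u∈B = slide-⁺ A─B≡x B─A≡y u∈A (λ u≡x → x≢u (sym u≡x))
      u≤′ : ∀ t → t ∈ B → l u ≤ l t
      u≤′ t t∈B with t ≟ y
      ... | no  t≢y = u≤ t (proj₁ (slide-⁻ A─B≡x B─A≡y t∈B t≢y))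
      ... | yes refl with l u ≤? l t
      ...   | yes lu≤lt = lu≤lt
      ...   | no  lu≰lt = ⊥-elim (<-irrefl refl (begin-strict
        l x   ≤⟨ proj₁ (proj₂ adj) ⟩
        r t   <⟨ independent-l<l⇒r<l indB t∈B u∈B (≰⇒> lu≰lt) ⟩
        l u   <⟨ l<r u ⟩
        r u   <⟨ leftmost-r<l indA lmu (proj₁ (slide-source A─B≡x B─A≡y)) x≢u ⟩
        l x   ∎))
        where open ≤-Reasoning

  Reconf-source : ∀ {P k A C} → Reconf G P k A C → IndepIn G P k A
  Reconf-source (done indA)     = indA
  Reconf-source (step indA _ _) = indA

  Reconf-drop-leftmost : ∀ {k w A C u v} (σ : Reconf G AllV k A C)
    → (∀ S x → _∈Seq_ G S σ → IsLeftmost G S x → r w ≤ r x)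
    → IsLeftmost G A u → IsLeftmost G C v
    → Reconf G (InGw G w) (k ∸ 1) (A - u) (C - v)
  Reconf-drop-leftmost {A = A} {u = u} (done indA) bound lmu lmv
    with refl ← leftmost-unique lmu lmv
    = done (IndepIn-drop-leftmost indA lmu (bound A u here-done lmu))
  Reconf-drop-leftmost {k} {w} {A} {C} {u} {v} (step {B = B} indA (x , y , A─B≡x , B─A≡y , adj) σ) bound lmu lmv
    with x ≟ u
  ... | yes refl = subst (λ S → Reconf G (InGw G w) (k ∸ 1) S (C - v)) (sym (slide-p-x≡q-y A─B≡x B─A≡y))
      (Reconf-drop-leftmost σ bound′ (slide-leftmost A─B≡x B─A≡y adj (proj₁ indA) lmu) lmv)
    where
    bound′ : ∀ S z → _∈Seq_ G S σ → IsLeftmost G S z → r w ≤ r z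
    bound′ S z S∈σ = bound S z (there S∈σ)
  ... | no  x≢u = step (IndepIn-drop-leftmost indA lmu (bound A u here-step lmu))
      (x , y , p─q≡⁅x⁆⇒p-z─[q-z]≡⁅x⁆ A─B≡x x≢u , p─q≡⁅x⁆⇒p-z─[q-z]≡⁅x⁆ B─A≡y y≢u , adj)
      (Reconf-drop-leftmost σ bound′ lmuB lmv)
    where
    bound′ : ∀ S z → _∈Seq_ G S σ → IsLeftmost G S z → r w ≤ r z
    bound′ S z S∈σ = bound S z (there S∈σ)
    lmuB : IsLeftmost G B u
    lmuB = slide-keeps-leftmost A─B≡x B─A≡y adj (proj₁ indA) (proj₁ (Reconf-source σ)) lmu x≢u
    y≢u : y ≢ u
    y≢u refl = proj₂ (slide-target A─B≡x B─A≡y) (proj₁ lmu)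

lemma12 : ∀ {n} (G : IntervalGraph n) (k : ℕ) (I J : Subset n)
    → IndepIn G AllV k I → IndepIn G AllV k J
    → (σ : Reconf G AllV k I J)
    → (u v w : Fin n)
    → IsLeftmost G I u → IsLeftmost G J v
    → (Σ (Subset n) λ S → _∈Seq_ G S σ × IsLeftmost G S w)
    → (∀ (S : Subset n) (x : Fin n) → _∈Seq_ G S σ → IsLeftmost G S x
         → IntervalGraph.r G w ≤ IntervalGraph.r G x)
    → Reconf G (InGw G w) (k ∸ 1) (I ─ ⁅ u ⁆) (J ─ ⁅ v ⁆)
lemma12 G k I J _ _ σ u v w lmu lmv _ bound = Reconf-drop-leftmost G σ bound lmu lmv
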